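{- Let $\mathsf{PAs}^{\leftarrow}$ be the graded vector space such that for each $n\geq 1$, $\mathsf{PAs}^{\leftarrow}(n)$ has basis $\{\mathsf{E}_u : u \in \mathfrak{P}[n]\}$, where $\mathfrak{P}[n]$ is the (infinite) set of packed words with set of letters exactly $[n]$. For $u \in \mathfrak{P}[n]$, $i \in [n]$ and $v \in \mathfrak{P}[m]$, define $\mathsf{E}_u \circ_i \mathsf{E}_v := \mathsf{E}_w$, where $w$ is the word obtained from $\mathrm{inc}_{m-1,i}(u)$ by replacing every occurrence of the letter $i$ by the word $\mathrm{inc}_{i-1,0}(v)$ (so $w \in \mathfrak{P}[n+m-1]$), extended bilinearly. For $u \in \mathfrak{P}[n]$ of length $\ell$ and $\sigma \in \mathfrak{S}_n$, define $\mathsf{E}_u \cdot \sigma := \mathsf{E}_{\sigma^{ -1}(u(1))\cdots\sigma^{ -1}(u(\ell))}$, extended linearly. Then $\mathsf{PAs}^{\leftarrow}$, endowed with the partial compositions $\circ_i$ and the action $\cdot$ of the symmetric groups, is a symmetric (unital) operad, with unit $\mathsf{E}_1$.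
   Context: $\mathbb{P}=\{1,2,\dots\}$, $[n]=\{1,\dots,n\}$, $\mathfrak{S}_n$ is the symmetric group on $[n]$. A packed word is a word over $\mathbb{P}$ whose set of letters is $[k]$ for some $k$. For a word $u$, $u(j)$ is its $j$-th letter. $\mathrm{inc}_{\alpha,\beta}(u)$ is the word obtained from $u$ by adding $\alpha$ to each letter strictly greater than $\beta$. Example: $\mathsf{E}_{231314}\circ_3\mathsf{E}_{122} = \mathsf{E}_{2344134415}$, and $\mathsf{E}_{1411232}\cdot 3142 = \mathsf{E}_{2322414}$. A symmetric operad here means: partial compositions satisfying sequential and parallel associativity, a two-sided unit in arity $1$, right actions of $\mathfrak{S}_n$ on arity $n$ components, and the usual equivariance compatibility between partial compositions and the actions. -}

module Defs where

open import Data.Nat using (ℕ; zero; suc; _+_; _∸_; _≤_; _<_; _<?_; _≡ᵇ_; _<ᵇ_)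
open import Data.Bool using (Bool; if_then_else_)
open import Data.List using (List; []; _∷_; [_]; map; concatMap)
open import Data.List.Relation.Unary.All using (All)
open import Data.List.Membership.Propositional using (_∈_)
open import Data.Fin using (Fin; toℕ; fromℕ<)
open import Data.Fin.Permutation using (Permutation′; _⟨$⟩ʳ_; _⟨$⟩ˡ_; _∘ₚ_; id)
open import Data.Product using (_×_)
open import Relation.Nullary using (yes; no)
open import Relation.Binary.PropositionalEquality using (_≡_)

-- Words are lists of natural numbers (letters are meant to be in ℙ = {1,2,...}).
Word : Set
Word = List ℕ

Packed : ℕ → Word → Set
Packed n u = All (λ a → 1 ≤ a × a ≤ n) u × (∀ a → 1 ≤ a → a ≤ n → a ∈ u)

inc : ℕ → ℕ → Word → Word
inc α β = map (λ a → if β <ᵇ a then a + α else a)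

replaceLetter : ℕ → Word → Word → Word
replaceLetter c w x = concatMap (λ a → if a ≡ᵇ c then x else [ a ]) w

-- E_u ∘_i E_v for v ∈ 𝔓[m]  (m = arity of the second argument).
comp : (m : ℕ) → Word → ℕ → Word → Word
comp m u i v = replaceLetter i (inc (m ∸ 1) i u) (inc (i ∸ 1) 0 v)

-- A permutation σ ∈ 𝔖_n (on Fin n) viewed as a map on letters 1..n (identity elsewhere).
permL : ∀ {n} → Permutation′ n → ℕ → ℕ
permL σ zero = zero
permL {n} σ (suc a) with a <? n
... | yes p = suc (toℕ (σ ⟨$⟩ʳ fromℕ< p))
... | no _  = suc a

permInvL : ∀ {n} → Permutation′ n → ℕ → ℕ
permInvL σ zero = zero
permInvL {n} σ (suc a) with a <? n
... | yes p = suc (toℕ (σ ⟨$⟩ˡ fromℕ< p))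
... | no _  = suc a

act : ∀ {n} → Word → Permutation′ n → Word
act u σ = map (permInvL σ) u

-- The block permutation σ ∘_i τ ∈ 𝔖_{n+m-1} (σ ∈ 𝔖_n, τ ∈ 𝔖_m), as a map on letters
-- 1..n+m-1, given σ and τ as maps on letters: positions i..i+m-1 form a block that is
-- sent to σ(i)..σ(i)+m-1 permuted by τ, other positions follow σ (renumbered).
blockPerm : (fσ : ℕ → ℕ) (i m : ℕ) (fτ : ℕ → ℕ) → ℕ → ℕ
blockPerm fσ i m fτ j =
  if j <ᵇ i then adj (fσ j)
  else if j <ᵇ i + m then (fσ i ∸ 1) + fτ (j ∸ i + 1)
  else adj (fσ (j ∸ (m ∸ 1)))
  where
  adj : ℕ → ℕ
  adj b = if b <ᵇ fσ i then b else b + (m ∸ 1)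

-- The axioms of a symmetric (unital) operad for PAs← on basis elements E_u,
-- u ∈ 𝔓[n], n ≥ 1 (the linear structure is the bilinear/linear extension).
record IsSymmetricOperadPAs : Set where
  field
    comp-packed : ∀ n m u v i → 1 ≤ n → 1 ≤ m → Packed n u → Packed m v →
                  1 ≤ i → i ≤ n → Packed (n + m ∸ 1) (comp m u i v)
    act-packed  : ∀ n u (σ : Permutation′ n) → 1 ≤ n → Packed n u → Packed n (act u σ)
    unit-packed : Packed 1 [ 1 ]
    unit-right  : ∀ n u i → 1 ≤ n → Packed n u → 1 ≤ i → i ≤ n → comp 1 u i [ 1 ] ≡ u
    unit-left   : ∀ n u → 1 ≤ n → Packed n u → comp n [ 1 ] 1 u ≡ u
    seq-assoc   : ∀ n m k x y z i j → 1 ≤ n → 1 ≤ m → 1 ≤ k →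
                  Packed n x → Packed m y → Packed k z →
                  1 ≤ i → i ≤ n → 1 ≤ j → j ≤ m →
                  comp k (comp m x i y) (i + j ∸ 1) z ≡ comp (m + k ∸ 1) x i (comp k y j z)
    par-assoc   : ∀ n m k x y z i j → 1 ≤ n → 1 ≤ m → 1 ≤ k →
                  Packed n x → Packed m y → Packed k z →
                  1 ≤ i → i < j → j ≤ n →
                  comp k (comp m x i y) (j + m ∸ 1) z ≡ comp m (comp k x j z) i y
    -- right action of 𝔖_n: x · id = x and (x · σ) · τ = x · (στ), (στ)(a) = σ(τ(a))
    act-id      : ∀ n u → 1 ≤ n → Packed n u → act u (id {n}) ≡ u
    act-comp    : ∀ n u (σ τ : Permutation′ n) → 1 ≤ n → Packed n u →
                  act (act u σ) τ ≡ act u (τ ∘ₚ σ)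
    equivariance : ∀ n m u v i (σ : Permutation′ n) (τ : Permutation′ m)
                   (ρ : Permutation′ (n + m ∸ 1)) → 1 ≤ n → 1 ≤ m →
                   Packed n u → Packed m v → 1 ≤ i → i ≤ n →
                   (∀ (j : Fin (n + m ∸ 1)) →
                      suc (toℕ (ρ ⟨$⟩ʳ j)) ≡ blockPerm (permL σ) i m (permL τ) (suc (toℕ j))) →
                   comp m (act u σ) i (act v τ) ≡ act (comp m u (permL σ i) v) ρ

-- A composite E_u ∘_i E_v is computed letter by letter: a letter a of u is kept if a < i, replaced
-- by inc_{i-1,0}(v) if a = i, and raised by m - 1 if a > i; this is graft i (m - 1) (inc_{i-1,0} v) a.
-- Each associativity law thus reduces to an identity between the images of a single letter, settled
-- by comparing the letter with the grafting positions.  For equivariance, applying the block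
-- permutation σ ∘_i τ letterwise to (u · σ) ∘_i (v · τ) gives u ∘_{σ(i)} v; as ρ agrees with σ ∘_i τ
-- on [n + m - 1], acting by ρ undoes it.
module Submission where

open import Defs
open import Function using (_∘′_)
open import Data.Bool using (true; false; if_then_else_)
open import Data.Fin using (toℕ; fromℕ<)
open import Data.Fin.Permutation using (Permutation′; _⟨$⟩ʳ_; _⟨$⟩ˡ_; _∘ₚ_; id; flip; inverseˡ; inverseʳ)
open import Data.Fin.Properties using (toℕ-fromℕ<; fromℕ<-toℕ; toℕ<n)
open import Data.List using (List; []; _∷_; [_]; map; concat; concatMap; _++_)
open import Data.List.Properties
  using (map-id; map-∘; map-cong; map-cong-local; map-id-local; ++-identityʳ;
         concatMap-cong; concatMap-map; map-concatMap; concatMap-++; concatMap-pure)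
open import Data.List.Relation.Unary.All as All using (All; []; _∷_)
open import Data.List.Relation.Unary.All.Properties using (map⁺; concat⁺)
open import Data.List.Relation.Unary.Any using (here)
open import Data.List.Membership.Propositional using (_∈_; lose)
open import Data.List.Membership.Propositional.Properties using (∈-map⁺; ∈-concatMap⁺)
open import Data.Nat using (ℕ; zero; suc; _+_; _∸_; _≤_; _<_; _<?_; _≤?_; _≡ᵇ_; _<ᵇ_; z≤n; s≤s)
open import Data.Nat.Properties
open import Algebra.Properties.CommutativeSemigroup +-commutativeSemigroup using (xy∙z≈xz∙y)
open import Data.Product using (_×_; _,_; proj₁; proj₂)
open import Relation.Binary using (tri<; tri≈; tri>)
open import Relation.Binary.PropositionalEquality hiding ([_])
open import Relation.Nullary using (yes; no; ¬_; contradiction)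
open ≡-Reasoning

<ᵇ-true : ∀ {m n} → m < n → (m <ᵇ n) ≡ true
<ᵇ-true {m} {n} m<n with m <ᵇ n | <⇒<ᵇ m<n
... | true | _ = refl

<ᵇ-false : ∀ {m n} → n ≤ m → (m <ᵇ n) ≡ false
<ᵇ-false {m} {n} n≤m with m <ᵇ n | <ᵇ⇒< m n
... | false | _ = refl
... | true | m<n = contradiction (m<n _) (≤⇒≯ n≤m)

≡ᵇ-refl : ∀ n → (n ≡ᵇ n) ≡ true
≡ᵇ-refl n with n ≡ᵇ n | ≡⇒≡ᵇ n n refl
... | true | _ = refl

≡ᵇ-false : ∀ {m n} → m ≢ n → (m ≡ᵇ n) ≡ false
≡ᵇ-false {m} {n} m≢n with m ≡ᵇ n | ≡ᵇ⇒≡ m n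
... | false | _ = refl
... | true | m≡n = contradiction (m≡n _) m≢n

m+[1+n]∸1≡m+n : ∀ m n → m + suc n ∸ 1 ≡ m + n
m+[1+n]∸1≡m+n m n = cong (_∸ 1) (+-suc m n)

concatMap-cong-local : ∀ {A B : Set} {f g : A → List B} {xs} →
                       All (λ x → f x ≡ g x) xs → concatMap f xs ≡ concatMap g xs
concatMap-cong-local fxs≡gxs = cong concat (map-cong-local fxs≡gxs)

concatMap-concatMap : ∀ {A B C : Set} (f : B → List C) (g : A → List B) xs →
                      concatMap f (concatMap g xs) ≡ concatMap (λ x → concatMap f (g x)) xs
concatMap-concatMap f g [] = refl
concatMap-concatMap f g (x ∷ xs) =
  trans (concatMap-++ f (g x) _) (cong (concatMap f (g x) ++_) (concatMap-concatMap f g xs))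

InRange : ℕ → ℕ → Set
InRange n a = 1 ≤ a × a ≤ n

incLetter : ℕ → ℕ → ℕ → ℕ
incLetter α β a = if β <ᵇ a then a + α else a

incLetter-≤ : ∀ α {β a} → a ≤ β → incLetter α β a ≡ a
incLetter-≤ α a≤β rewrite <ᵇ-false a≤β = refl

incLetter-> : ∀ α {β a} → β < a → incLetter α β a ≡ a + α
incLetter-> α β<a rewrite <ᵇ-true β<a = refl

incLetter-zero : ∀ β a → incLetter 0 β a ≡ a
incLetter-zero β a with a ≤? β
... | yes a≤β = incLetter-≤ 0 a≤β
... | no a≰β = trans (incLetter-> 0 (≰⇒> a≰β)) (+-identityʳ a)

inc₀-inc₀ : ∀ α β w → inc α 0 (inc β 0 w) ≡ inc (β + α) 0 w
inc₀-inc₀ α β w = trans (sym (map-∘ w)) (map-cong shift-shift w)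
  where
  shift-shift : ∀ a → incLetter α 0 (incLetter β 0 a) ≡ incLetter (β + α) 0 a
  shift-shift zero = refl
  shift-shift (suc a) = +-assoc (suc a) β α

inc-zero : ∀ β w → inc 0 β w ≡ w
inc-zero β w = trans (map-cong (incLetter-zero β) w) (map-id w)

graft : ℕ → ℕ → Word → ℕ → Word
graft c α X a = if incLetter α c a ≡ᵇ c then X else [ incLetter α c a ]

comp≡concatMap-graft : ∀ m u i v → comp m u i v ≡ concatMap (graft i (m ∸ 1) (inc (i ∸ 1) 0 v)) u
comp≡concatMap-graft m u i v = concatMap-map _ _ u

graft-< : ∀ {c} α X {a} → a < c → graft c α X a ≡ [ a ]
graft-< α X a<c rewrite incLetter-≤ α (<⇒≤ a<c) | ≡ᵇ-false (<⇒≢ a<c) = refl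

graft-≡ : ∀ c α X → graft c α X c ≡ X
graft-≡ c α X rewrite incLetter-≤ α (≤-refl {c}) | ≡ᵇ-refl c = refl

graft-> : ∀ {c} α X {a} → c < a → graft c α X a ≡ [ a + α ]
graft-> α X {a} c<a rewrite incLetter-> α c<a | ≡ᵇ-false (>⇒≢ (<-≤-trans c<a (m≤m+n a α))) = refl

graft-≢ : ∀ {c} α X {a} → a ≢ c → graft c α X a ≡ [ incLetter α c a ]
graft-≢ {c} α X {a} a≢c with <-cmp a c
... | tri< a<c _ _ = trans (graft-< α X a<c) (cong [_] (sym (incLetter-≤ α (<⇒≤ a<c))))
... | tri≈ _ a≡c _ = contradiction a≡c a≢c
... | tri> _ _ c<a = trans (graft-> α X c<a) (cong [_] (sym (incLetter-> α c<a)))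

graft-translate : ∀ c α X s {a} → 1 ≤ a →
                  graft (c + s) α (map (incLetter s 0) X) (a + s) ≡ map (incLetter s 0) (graft c α X a)
graft-translate c α X s {a} 1≤a with <-cmp a c
... | tri< a<c _ _ = begin
  graft (c + s) α _ (a + s)          ≡⟨ graft-< α _ (+-monoˡ-< s a<c) ⟩
  [ a + s ]                          ≡⟨ cong [_] (incLetter-> s 1≤a) ⟨
  map (incLetter s 0) [ a ]          ≡⟨ cong (map _) (graft-< α X a<c) ⟨
  map (incLetter s 0) (graft c α X a) ∎
... | tri≈ _ refl _ = trans (graft-≡ (c + s) α _) (cong (map _) (sym (graft-≡ c α X)))
... | tri> _ _ c<a = begin
  graft (c + s) α _ (a + s)          ≡⟨ graft-> α _ (+-monoˡ-< s c<a) ⟩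
  [ a + s + α ]                      ≡⟨ cong [_] (xy∙z≈xz∙y a s α) ⟩
  [ a + α + s ]                      ≡⟨ cong [_] (incLetter-> s (≤-trans 1≤a (m≤m+n a α))) ⟨
  map (incLetter s 0) [ a + α ]      ≡⟨ cong (map _) (graft-> α X c<a) ⟨
  map (incLetter s 0) (graft c α X a) ∎

concatMap-graft-below : ∀ {c} α X {w} → All (_< c) w → concatMap (graft c α X) w ≡ w
concatMap-graft-below α X {w} w<c =
  trans (concatMap-cong-local (All.map (graft-< α X) w<c)) (concatMap-pure w)

concatMap-graft-above : ∀ {c} α X {w} → All (c <_) w → concatMap (graft c α X) w ≡ map (_+ α) w
concatMap-graft-above α X {w} c<w =
  trans (concatMap-cong-local (All.map (graft-> α X) c<w))
        (trans (sym (concatMap-map [_] (_+ α) w)) (concatMap-pure (map (_+ α) w)))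

permL-suc : ∀ {n} (σ : Permutation′ n) {a} (a<n : a < n) → permL σ (suc a) ≡ suc (toℕ (σ ⟨$⟩ʳ fromℕ< a<n))
permL-suc {n} σ {a} a<n with a <? n
... | yes _ = refl
... | no a≮n = contradiction a<n a≮n

permL-toℕ : ∀ {n} (σ : Permutation′ n) j → permL σ (suc (toℕ j)) ≡ suc (toℕ (σ ⟨$⟩ʳ j))
permL-toℕ σ j = trans (permL-suc σ (toℕ<n j)) (cong (λ k → suc (toℕ (σ ⟨$⟩ʳ k))) (fromℕ<-toℕ j (toℕ<n j)))

permInvL≡permL-flip : ∀ {n} (σ : Permutation′ n) a → permInvL σ a ≡ permL (flip σ) a
permInvL≡permL-flip σ zero = refl
permInvL≡permL-flip {n} σ (suc a) with a <? n
... | yes _ = refl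
... | no _ = refl

permL-inRange : ∀ {n} (σ : Permutation′ n) {a} → InRange n a → InRange n (permL σ a)
permL-inRange σ {suc a} (_ , a<n) rewrite permL-suc σ a<n = s≤s z≤n , toℕ<n _

permInvL-inRange : ∀ {n} (σ : Permutation′ n) {a} → InRange n a → InRange n (permInvL σ a)
permInvL-inRange σ {a} a∈ rewrite permInvL≡permL-flip σ a = permL-inRange (flip σ) a∈

permL-inverse : ∀ {n} (σ π : Permutation′ n) → (∀ {j} → π ⟨$⟩ʳ (σ ⟨$⟩ʳ j) ≡ j) →
                ∀ {a} → InRange n a → permL π (permL σ a) ≡ a
permL-inverse σ π πσ≗id {suc a} (_ , a<n) = begin
  permL π (permL σ (suc a))                 ≡⟨ cong (permL π) (permL-suc σ a<n) ⟩
  permL π (suc (toℕ (σ ⟨$⟩ʳ fromℕ< a<n)))   ≡⟨ permL-toℕ π _ ⟩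
  suc (toℕ (π ⟨$⟩ʳ (σ ⟨$⟩ʳ fromℕ< a<n)))    ≡⟨ cong (suc ∘′ toℕ) πσ≗id ⟩
  suc (toℕ (fromℕ< a<n))                    ≡⟨ cong suc (toℕ-fromℕ< a<n) ⟩
  suc a                                     ∎

permInvL-permL : ∀ {n} (σ : Permutation′ n) {a} → InRange n a → permInvL σ (permL σ a) ≡ a
permInvL-permL σ {a} a∈ =
  trans (permInvL≡permL-flip σ (permL σ a)) (permL-inverse σ (flip σ) (inverseˡ σ) a∈)

permL-permInvL : ∀ {n} (σ : Permutation′ n) {a} → InRange n a → permL σ (permInvL σ a) ≡ a
permL-permInvL σ {a} a∈ =
  trans (cong (permL σ) (permInvL≡permL-flip σ a)) (permL-inverse (flip σ) σ (inverseʳ σ) a∈)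

permL-unique : ∀ {n} (σ : Permutation′ n) (f : ℕ → ℕ) →
               (∀ j → suc (toℕ (σ ⟨$⟩ʳ j)) ≡ f (suc (toℕ j))) →
               ∀ {a} → InRange n a → f a ≡ permL σ a
permL-unique σ f σ≗f {suc a} (_ , a<n) = begin
  f (suc a)                         ≡⟨ cong (f ∘′ suc) (toℕ-fromℕ< a<n) ⟨
  f (suc (toℕ (fromℕ< a<n)))        ≡⟨ σ≗f (fromℕ< a<n) ⟨
  suc (toℕ (σ ⟨$⟩ʳ fromℕ< a<n))     ≡⟨ permL-suc σ a<n ⟨
  permL σ (suc a)                   ∎

permInvL-outside : ∀ {n} (σ : Permutation′ n) {a} → ¬ a < n → permInvL σ (suc a) ≡ suc a
permInvL-outside {n} σ {a} a≮n with a <? n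
... | yes a<n = contradiction a<n a≮n
... | no _ = refl

permInvL-id : ∀ {n} a → permInvL (id {n}) a ≡ a
permInvL-id zero = refl
permInvL-id {n} (suc a) with a <? n
... | yes a<n = cong suc (toℕ-fromℕ< a<n)
... | no _ = refl

permInvL-∘ₚ : ∀ {n} (σ τ : Permutation′ n) a → permInvL τ (permInvL σ a) ≡ permInvL (τ ∘ₚ σ) a
permInvL-∘ₚ σ τ zero = refl
permInvL-∘ₚ {n} σ τ (suc a) with a <? n
... | yes a<n = trans (permInvL≡permL-flip τ _) (permL-toℕ (flip τ) (σ ⟨$⟩ˡ fromℕ< a<n))
... | no a≮n = permInvL-outside τ a≮n

act-id : ∀ {n} u → act u (id {n}) ≡ u
act-id u = trans (map-cong permInvL-id u) (map-id u)

act-∘ₚ : ∀ {n} u (σ τ : Permutation′ n) → act (act u σ) τ ≡ act u (τ ∘ₚ σ)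
act-∘ₚ u σ τ = trans (sym (map-∘ u)) (map-cong (permInvL-∘ₚ σ τ) u)

act-packed : ∀ {n} {u} (σ : Permutation′ n) → Packed n u → Packed n (act u σ)
act-packed {n} {u} σ (u∈ , u⊇) = map⁺ (All.map (permInvL-inRange σ) u∈) , covers
  where
  covers : ∀ a → 1 ≤ a → a ≤ n → a ∈ act u σ
  covers a 1≤a a≤n = subst (_∈ act u σ) (permInvL-permL σ (1≤a , a≤n))
                       (∈-map⁺ (permInvL σ) (u⊇ (permL σ a) (proj₁ σa∈) (proj₂ σa∈)))
    where σa∈ = permL-inRange σ (1≤a , a≤n)

comp-letters : ∀ {n m u v i} → All (InRange n) u → All (InRange (suc m)) v → suc i ≤ n →
               All (InRange (n + m)) (comp (suc m) u (suc i) v)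
comp-letters {n} {m} {u} {v} {i} u∈ v∈ i<n =
  subst (All (InRange (n + m))) (sym (comp≡concatMap-graft (suc m) u (suc i) v))
    (concat⁺ (map⁺ (All.map graft-letters u∈)))
  where
  shifted : ∀ {c} → InRange (suc m) c → InRange (n + m) (incLetter i 0 c)
  shifted {c} (1≤c , c≤m) rewrite incLetter-> i 1≤c = ≤-trans 1≤c (m≤m+n c i) , c+i≤n+m
    where
    c+i≤n+m : c + i ≤ n + m
    c+i≤n+m = ≤-trans (+-monoˡ-≤ i c≤m) (subst₂ _≤_ (+-suc m i) (+-comm m n) (+-monoʳ-≤ m i<n))
  graft-letters : ∀ {a} → InRange n a → All (InRange (n + m)) (graft (suc i) m (inc i 0 v) a)
  graft-letters {a} (1≤a , a≤n) with <-cmp a (suc i)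
  ... | tri< a<i _ _ rewrite graft-< m (inc i 0 v) a<i = (1≤a , ≤-trans a≤n (m≤m+n n m)) ∷ []
  ... | tri≈ _ refl _ rewrite graft-≡ (suc i) m (inc i 0 v) = map⁺ (All.map shifted v∈)
  ... | tri> _ _ i<a rewrite graft-> m (inc i 0 v) i<a = (≤-trans 1≤a (m≤m+n a m) , +-monoˡ-≤ m a≤n) ∷ []

comp-covers : ∀ {n m u v i} → (∀ a → 1 ≤ a → a ≤ n → a ∈ u) → (∀ c → 1 ≤ c → c ≤ suc m → c ∈ v) →
              suc i ≤ n → ∀ b → 1 ≤ b → b ≤ n + m → b ∈ comp (suc m) u (suc i) v
comp-covers {n} {m} {u} {v} {i} u⊇ v⊇ i<n b 1≤b b≤n+m =
  subst (b ∈_) (sym (comp≡concatMap-graft (suc m) u (suc i) v)) covered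
  where
  G = graft (suc i) m (inc i 0 v)
  via : ∀ {a} → a ∈ u → b ∈ G a → b ∈ concatMap G u
  via a∈u b∈Ga = ∈-concatMap⁺ G (lose a∈u b∈Ga)
  covered : b ∈ concatMap G u
  covered with b ≤? i
  ... | yes b≤i = via (u⊇ b 1≤b (≤-trans b≤i (≤-trans (n≤1+n i) i<n)))
                      (subst (b ∈_) (sym (graft-< m _ (s≤s b≤i))) (here refl))
  ... | no b≰i with b ≤? i + suc m
  ...   | yes b≤i+m = via (u⊇ (suc i) (s≤s z≤n) i<n) (subst (b ∈_) (sym (graft-≡ (suc i) m _)) b∈block)
    where
    c = b ∸ i
    1≤c : 1 ≤ c
    1≤c = m<n⇒0<n∸m (≰⇒> b≰i)
    c≤m : c ≤ suc m
    c≤m = subst (c ≤_) (m+n∸m≡n i (suc m)) (∸-monoˡ-≤ i b≤i+m)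
    c+i≡b : incLetter i 0 c ≡ b
    c+i≡b = trans (incLetter-> i 1≤c) (m∸n+n≡m (<⇒≤ (≰⇒> b≰i)))
    b∈block : b ∈ inc i 0 v
    b∈block = subst (_∈ inc i 0 v) c+i≡b (∈-map⁺ (incLetter i 0) (v⊇ c 1≤c c≤m))
  ...   | no b≰i+m = via (u⊇ a (≤-trans (s≤s z≤n) i<a) a≤n)
                         (subst (b ∈_) (sym (graft-> m _ i<a)) (here (sym a+m≡b)))
    where
    a = b ∸ m
    a+m≡b : a + m ≡ b
    a+m≡b = m∸n+n≡m (≤-trans (m≤n+m m (suc i)) (<⇒≤ (subst (_< b) (+-suc i m) (≰⇒> b≰i+m))))
    i<a : suc i < a
    i<a = +-cancelʳ-< m (suc i) a (subst₂ _<_ (+-suc i m) (sym a+m≡b) (≰⇒> b≰i+m))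
    a≤n : a ≤ n
    a≤n = subst (a ≤_) (m+n∸n≡m n m) (∸-monoˡ-≤ m b≤n+m)

comp-packed : ∀ {n m u v i} → Packed n u → Packed (suc m) v → suc i ≤ n →
              Packed (n + suc m ∸ 1) (comp (suc m) u (suc i) v)
comp-packed {n} {m} {u} {v} {i} (u∈ , u⊇) (v∈ , v⊇) i<n =
  subst (λ N → Packed N (comp (suc m) u (suc i) v)) (sym (m+[1+n]∸1≡m+n n m))
    (comp-letters u∈ v∈ i<n , comp-covers u⊇ v⊇ i<n)

comp-unitʳ : ∀ u i → comp 1 u (suc i) [ 1 ] ≡ u
comp-unitʳ u i = begin
  comp 1 u (suc i) [ 1 ]                          ≡⟨ comp≡concatMap-graft 1 u (suc i) [ 1 ] ⟩
  concatMap (graft (suc i) 0 [ suc i ]) u        ≡⟨ concatMap-cong unit u ⟩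
  concatMap [_] u                                 ≡⟨ concatMap-pure u ⟩
  u                                               ∎
  where
  unit : ∀ a → graft (suc i) 0 [ suc i ] a ≡ [ a ]
  unit a with <-cmp a (suc i)
  ... | tri< a<i _ _ = graft-< 0 _ a<i
  ... | tri≈ _ refl _ = graft-≡ (suc i) 0 _
  ... | tri> _ _ i<a = trans (graft-> 0 _ i<a) (cong [_] (+-identityʳ a))

comp-unitˡ : ∀ n u → comp n [ 1 ] 1 u ≡ u
comp-unitˡ n u = begin
  comp n [ 1 ] 1 u                       ≡⟨ comp≡concatMap-graft n [ 1 ] 1 u ⟩
  graft 1 (n ∸ 1) (inc 0 0 u) 1 ++ []    ≡⟨ ++-identityʳ _ ⟩
  graft 1 (n ∸ 1) (inc 0 0 u) 1          ≡⟨ graft-≡ 1 (n ∸ 1) _ ⟩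
  inc 0 0 u                              ≡⟨ inc-zero 0 u ⟩
  u                                      ∎

comp-comp≡concatMap-graft : ∀ k m x y z i p →
                            comp k (comp m x i y) p z
                            ≡ concatMap (λ a → concatMap (graft p (k ∸ 1) (inc (p ∸ 1) 0 z))
                                                         (graft i (m ∸ 1) (inc (i ∸ 1) 0 y) a)) x
comp-comp≡concatMap-graft k m x y z i p =
  trans (comp≡concatMap-graft k (comp m x i y) p z)
        (trans (cong (concatMap Outer) (comp≡concatMap-graft m x i y)) (concatMap-concatMap Outer _ x))
  where Outer = graft p (k ∸ 1) (inc (p ∸ 1) 0 z)

graft-graft-nested : ∀ {m k} y z i j → All (1 ≤_) y → j ≤ m → ∀ a →
                     concatMap (graft (i + suc j) k (inc (i + suc j ∸ 1) 0 z)) (graft (suc i) m (inc i 0 y) a)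
                     ≡ graft (suc i) (m + suc k ∸ 1) (inc i 0 (comp (suc k) y (suc j) z)) a
graft-graft-nested {m} {k} y z i j 1≤y j≤m = letterwise
  where
  P = i + suc j
  W = comp (suc k) y (suc j) z
  Z = inc j 0 z
  Inner = graft (suc i) m (inc i 0 y)
  Outer = graft P k (inc (P ∸ 1) 0 z)

  outer-translate : ∀ {c} → 1 ≤ c → Outer (incLetter i 0 c) ≡ map (incLetter i 0) (graft (suc j) k Z c)
  outer-translate {c} 1≤c = begin
    Outer (incLetter i 0 c)                   ≡⟨ cong Outer (incLetter-> i 1≤c) ⟩
    graft P k (inc (P ∸ 1) 0 z) (c + i)       ≡⟨ cong₂ (λ p X → graft p k X (c + i)) (+-comm i (suc j)) Z-shift ⟩
    graft (suc j + i) k (inc i 0 Z) (c + i)   ≡⟨ graft-translate (suc j) k Z i 1≤c ⟩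
    map (incLetter i 0) (graft (suc j) k Z c) ∎
    where
    Z-shift : inc (P ∸ 1) 0 z ≡ inc i 0 Z
    Z-shift = trans (cong (λ α → inc α 0 z) (trans (m+[1+n]∸1≡m+n i j) (+-comm i j))) (sym (inc₀-inc₀ i j z))

  letterwise : ∀ a → concatMap Outer (Inner a) ≡ graft (suc i) (m + suc k ∸ 1) (inc i 0 W) a
  letterwise a with <-cmp a (suc i)
  ... | tri< a<i _ _ = begin
    concatMap Outer (Inner a)   ≡⟨ cong (concatMap Outer) (graft-< m _ a<i) ⟩
    concatMap Outer [ a ]       ≡⟨ concatMap-graft-below k _ (<-≤-trans a<i i<P ∷ []) ⟩
    [ a ]                       ≡⟨ graft-< _ _ a<i ⟨
    graft (suc i) (m + suc k ∸ 1) (inc i 0 W) a ∎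
    where
    i<P : suc i ≤ P
    i<P = subst (suc i ≤_) (sym (+-suc i j)) (s≤s (m≤m+n i j))
  ... | tri≈ _ refl _ = begin
    concatMap Outer (Inner (suc i))                        ≡⟨ cong (concatMap Outer) (graft-≡ (suc i) m _) ⟩
    concatMap Outer (map (incLetter i 0) y)                ≡⟨ concatMap-map Outer (incLetter i 0) y ⟩
    concatMap (λ c → Outer (incLetter i 0 c)) y            ≡⟨ concatMap-cong-local (All.map outer-translate 1≤y) ⟩
    concatMap (λ c → map (incLetter i 0) (graft (suc j) k Z c)) y
                                                           ≡⟨ map-concatMap (incLetter i 0) _ y ⟨
    map (incLetter i 0) (concatMap (graft (suc j) k Z) y)  ≡⟨ cong (map _) (comp≡concatMap-graft (suc k) y (suc j) z) ⟨
    inc i 0 W                                              ≡⟨ graft-≡ (suc i) _ _ ⟨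
    graft (suc i) (m + suc k ∸ 1) (inc i 0 W) (suc i)      ∎
  ... | tri> _ _ i<a = begin
    concatMap Outer (Inner a)   ≡⟨ cong (concatMap Outer) (graft-> m _ i<a) ⟩
    concatMap Outer [ a + m ]   ≡⟨ concatMap-graft-above k _ (P<a+m ∷ []) ⟩
    [ a + m + k ]               ≡⟨ cong [_] (+-assoc a m k) ⟩
    [ a + (m + k) ]             ≡⟨ cong (λ α → [ a + α ]) (m+[1+n]∸1≡m+n m k) ⟨
    [ a + (m + suc k ∸ 1) ]     ≡⟨ graft-> _ _ i<a ⟨
    graft (suc i) (m + suc k ∸ 1) (inc i 0 W) a ∎
    where
    P<a+m : P < a + m
    P<a+m = subst (_< a + m) (sym (+-suc i j)) (+-mono-<-≤ i<a j≤m)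

comp-seq-assoc : ∀ {m k} x y z i j → All (1 ≤_) y → j ≤ m →
                 comp (suc k) (comp (suc m) x (suc i) y) (i + suc j) z
                 ≡ comp (m + suc k) x (suc i) (comp (suc k) y (suc j) z)
comp-seq-assoc {m} {k} x y z i j 1≤y j≤m =
  trans (comp-comp≡concatMap-graft (suc k) (suc m) x y z (suc i) (i + suc j))
        (trans (concatMap-cong (graft-graft-nested y z i j 1≤y j≤m) x)
               (sym (comp≡concatMap-graft (m + suc k) x (suc i) (comp (suc k) y (suc j) z))))

graft-graft-disjoint : ∀ {m k} y z i j → All (InRange (suc m)) y → All (1 ≤_) z → i < j → ∀ a →
                       concatMap (graft (j + suc m) k (inc (j + suc m ∸ 1) 0 z)) (graft (suc i) m (inc i 0 y) a)
                       ≡ concatMap (graft (suc i) m (inc i 0 y)) (graft (suc j) k (inc j 0 z) a)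
graft-graft-disjoint {m} {k} y z i j y∈ 1≤z i<j = letterwise
  where
  Q = j + suc m
  Gy = graft (suc i) m (inc i 0 y)
  Gz = graft (suc j) k (inc j 0 z)
  Gz′ = graft Q k (inc (Q ∸ 1) 0 z)

  y-below-Q : All (_< Q) (inc i 0 y)
  y-below-Q = map⁺ (All.map below y∈)
    where
    below : ∀ {c} → InRange (suc m) c → incLetter i 0 c < Q
    below {c} (1≤c , c≤m) rewrite incLetter-> i 1≤c = subst (c + i <_) (+-comm (suc m) j) (+-mono-≤-< c≤m i<j)

  z-above-i : All (suc i <_) (inc j 0 z)
  z-above-i = map⁺ (All.map above 1≤z)
    where
    above : ∀ {d} → 1 ≤ d → suc i < incLetter j 0 d
    above {d} 1≤d rewrite incLetter-> j 1≤d = +-mono-≤-< 1≤d i<j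

  z-shift : inc (Q ∸ 1) 0 z ≡ map (_+ m) (inc j 0 z)
  z-shift = begin
    inc (Q ∸ 1) 0 z                        ≡⟨ cong (λ α → inc α 0 z) (m+[1+n]∸1≡m+n j m) ⟩
    inc (j + m) 0 z                        ≡⟨ map-cong-local (All.map shift 1≤z) ⟩
    map (λ d → incLetter j 0 d + m) z      ≡⟨ map-∘ z ⟩
    map (_+ m) (inc j 0 z)                 ∎
    where
    shift : ∀ {d} → 1 ≤ d → incLetter (j + m) 0 d ≡ incLetter j 0 d + m
    shift {d} 1≤d = trans (incLetter-> (j + m) 1≤d)
                          (trans (sym (+-assoc d j m)) (cong (_+ m) (sym (incLetter-> j 1≤d))))

  letterwise : ∀ a → concatMap Gz′ (Gy a) ≡ concatMap Gy (Gz a)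
  letterwise a with <-cmp a (suc i)
  ... | tri< a<i _ _ = begin
    concatMap Gz′ (Gy a)    ≡⟨ cong (concatMap Gz′) (graft-< m _ a<i) ⟩
    concatMap Gz′ [ a ]     ≡⟨ concatMap-graft-below k _ (a<Q ∷ []) ⟩
    [ a ]                   ≡⟨ concatMap-graft-below m _ (a<i ∷ []) ⟨
    concatMap Gy [ a ]      ≡⟨ cong (concatMap Gy) (graft-< k _ (<-trans a<i (s≤s i<j))) ⟨
    concatMap Gy (Gz a)     ∎
    where
    a<Q : a < Q
    a<Q = <-≤-trans (<-trans a<i (s≤s i<j)) (subst (suc j ≤_) (sym (+-suc j m)) (s≤s (m≤m+n j m)))
  ... | tri≈ _ refl _ = begin
    concatMap Gz′ (Gy (suc i))   ≡⟨ cong (concatMap Gz′) (graft-≡ (suc i) m _) ⟩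
    concatMap Gz′ (inc i 0 y)    ≡⟨ concatMap-graft-below k _ y-below-Q ⟩
    inc i 0 y                    ≡⟨ ++-identityʳ _ ⟨
    inc i 0 y ++ []              ≡⟨ cong (_++ []) (graft-≡ (suc i) m _) ⟨
    concatMap Gy [ suc i ]       ≡⟨ cong (concatMap Gy) (graft-< k _ (s≤s i<j)) ⟨
    concatMap Gy (Gz (suc i))    ∎
  ... | tri> _ _ i<a with <-cmp a (suc j)
  ...   | tri< a<j _ _ = begin
    concatMap Gz′ (Gy a)    ≡⟨ cong (concatMap Gz′) (graft-> m _ i<a) ⟩
    concatMap Gz′ [ a + m ] ≡⟨ concatMap-graft-below k _ (a+m<Q ∷ []) ⟩
    [ a + m ]               ≡⟨ concatMap-graft-above m _ (i<a ∷ []) ⟨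
    concatMap Gy [ a ]      ≡⟨ cong (concatMap Gy) (graft-< k _ a<j) ⟨
    concatMap Gy (Gz a)     ∎
    where
    a+m<Q : a + m < Q
    a+m<Q = subst (a + m <_) (sym (+-suc j m)) (+-monoˡ-< m a<j)
  ...   | tri≈ _ refl _ = begin
    concatMap Gz′ (Gy (suc j))      ≡⟨ cong (concatMap Gz′) (graft-> m _ i<a) ⟩
    Gz′ (suc j + m) ++ []           ≡⟨ ++-identityʳ _ ⟩
    Gz′ (suc j + m)                 ≡⟨ cong Gz′ (+-suc j m) ⟨
    Gz′ Q                           ≡⟨ graft-≡ Q k _ ⟩
    inc (Q ∸ 1) 0 z                 ≡⟨ z-shift ⟩
    map (_+ m) (inc j 0 z)          ≡⟨ concatMap-graft-above m _ z-above-i ⟨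
    concatMap Gy (inc j 0 z)        ≡⟨ cong (concatMap Gy) (graft-≡ (suc j) k _) ⟨
    concatMap Gy (Gz (suc j))       ∎
  ...   | tri> _ _ j<a = begin
    concatMap Gz′ (Gy a)        ≡⟨ cong (concatMap Gz′) (graft-> m _ i<a) ⟩
    concatMap Gz′ [ a + m ]     ≡⟨ concatMap-graft-above k _ (Q<a+m ∷ []) ⟩
    [ a + m + k ]               ≡⟨ cong [_] (xy∙z≈xz∙y a m k) ⟩
    [ a + k + m ]               ≡⟨ concatMap-graft-above m _ (<-≤-trans i<a (m≤m+n a k) ∷ []) ⟨
    concatMap Gy [ a + k ]      ≡⟨ cong (concatMap Gy) (graft-> k _ j<a) ⟨
    concatMap Gy (Gz a)         ∎
    where
    Q<a+m : Q < a + m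
    Q<a+m = subst (_< a + m) (sym (+-suc j m)) (+-monoˡ-< m j<a)

comp-par-assoc : ∀ {m k} x y z i j → All (InRange (suc m)) y → All (1 ≤_) z → i < j →
                 comp (suc k) (comp (suc m) x (suc i) y) (j + suc m) z
                 ≡ comp (suc m) (comp (suc k) x (suc j) z) (suc i) y
comp-par-assoc {m} {k} x y z i j y∈ 1≤z i<j =
  trans (comp-comp≡concatMap-graft (suc k) (suc m) x y z (suc i) (j + suc m))
        (trans (concatMap-cong (graft-graft-disjoint y z i j y∈ 1≤z i<j) x)
               (sym (comp-comp≡concatMap-graft (suc m) (suc k) x z y (suc j) (suc i))))

adjust≡incLetter : ∀ α {b c} → b ≢ c → (if b <ᵇ c then b else b + α) ≡ incLetter α c b
adjust≡incLetter α {b} {c} b≢c with <-cmp b c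
... | tri< b<c _ _ rewrite <ᵇ-true b<c = sym (incLetter-≤ α (<⇒≤ b<c))
... | tri≈ _ b≡c _ = contradiction b≡c b≢c
... | tri> _ _ c<b rewrite <ᵇ-false (<⇒≤ c<b) = sym (incLetter-> α c<b)

blockPerm-below : ∀ fσ {i} m fτ {j} → j < i → fσ j ≢ fσ i →
                  blockPerm fσ i m fτ j ≡ incLetter (m ∸ 1) (fσ i) (fσ j)
blockPerm-below fσ m fτ j<i ne rewrite <ᵇ-true j<i = adjust≡incLetter (m ∸ 1) ne

blockPerm-block : ∀ fσ {i} m fτ {j} → i ≤ j → j < i + m → blockPerm fσ i m fτ j ≡ (fσ i ∸ 1) + fτ (j ∸ i + 1)
blockPerm-block fσ m fτ i≤j j<i+m rewrite <ᵇ-false i≤j | <ᵇ-true j<i+m = refl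

blockPerm-above : ∀ fσ {i} m fτ {j} → i + m ≤ j → fσ (j ∸ (m ∸ 1)) ≢ fσ i →
                  blockPerm fσ i m fτ j ≡ incLetter (m ∸ 1) (fσ i) (fσ (j ∸ (m ∸ 1)))
blockPerm-above fσ {i} m fτ i+m≤j ne rewrite <ᵇ-false (≤-trans (m≤m+n i m) i+m≤j) | <ᵇ-false i+m≤j =
  adjust≡incLetter (m ∸ 1) ne

act-map-inverse : ∀ {N} (ρ : Permutation′ N) (f : ℕ → ℕ) → (∀ j → suc (toℕ (ρ ⟨$⟩ʳ j)) ≡ f (suc (toℕ j))) →
                  ∀ {w} → All (InRange N) w → act (map f w) ρ ≡ w
act-map-inverse ρ f ρ≗f {w} w∈ = trans (sym (map-∘ w)) (map-id-local (All.map inverts w∈))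
  where
  inverts : ∀ {a} → InRange _ a → permInvL ρ (f a) ≡ a
  inverts a∈ = trans (cong (permInvL ρ) (permL-unique ρ f ρ≗f a∈)) (permInvL-permL ρ a∈)

map-blockPerm-comp : ∀ {n m u v i} (σ : Permutation′ n) (τ : Permutation′ (suc m)) →
                     All (InRange n) u → All (InRange (suc m)) v → suc i ≤ n →
                     map (blockPerm (permL σ) (suc i) (suc m) (permL τ)) (comp (suc m) (act u σ) (suc i) (act v τ))
                     ≡ comp (suc m) u (permL σ (suc i)) v
map-blockPerm-comp {n} {m} {u} {v} {i} σ τ u∈ v∈ i<n = begin
  map B (comp (suc m) (act u σ) (suc i) (act v τ))
    ≡⟨ cong (map B) (comp≡concatMap-graft (suc m) (act u σ) (suc i) (act v τ)) ⟩
  map B (concatMap F (act u σ))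
    ≡⟨ cong (map B) (concatMap-map F (permInvL σ) u) ⟩
  map B (concatMap (λ a → F (permInvL σ a)) u)
    ≡⟨ map-concatMap B _ u ⟩
  concatMap (λ a → map B (F (permInvL σ a))) u
    ≡⟨ concatMap-cong-local (All.map letterwise u∈) ⟩
  concatMap G u
    ≡⟨ comp≡concatMap-graft (suc m) u s v ⟨
  comp (suc m) u s v
    ∎
  where
  s = permL σ (suc i)
  B = blockPerm (permL σ) (suc i) (suc m) (permL τ)
  F = graft (suc i) m (inc i 0 (act v τ))
  G = graft s m (inc (s ∸ 1) 0 v)

  off-block : ∀ {a} → permInvL σ a ≢ suc i → a ≢ s
  off-block σ⁻¹a≢i a≡s = σ⁻¹a≢i (trans (cong (permInvL σ) a≡s) (permInvL-permL σ (s≤s z≤n , i<n)))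

  block : ∀ {c} → InRange (suc m) c → B (incLetter i 0 (permInvL τ c)) ≡ incLetter (s ∸ 1) 0 c
  block {c} c∈ = begin
    B (incLetter i 0 t)                     ≡⟨ cong B (incLetter-> i 1≤t) ⟩
    B (t + i)                               ≡⟨ blockPerm-block (permL σ) (suc m) (permL τ) (+-monoˡ-≤ i 1≤t) t+i<i+m ⟩
    (s ∸ 1) + permL τ (t + i ∸ suc i + 1)   ≡⟨ cong (λ k → (s ∸ 1) + permL τ k) (unshift t 1≤t) ⟩
    (s ∸ 1) + permL τ t                     ≡⟨ cong ((s ∸ 1) +_) (permL-permInvL τ c∈) ⟩
    (s ∸ 1) + c                             ≡⟨ +-comm (s ∸ 1) c ⟩
    c + (s ∸ 1)                             ≡⟨ incLetter-> (s ∸ 1) (proj₁ c∈) ⟨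
    incLetter (s ∸ 1) 0 c                   ∎
    where
    t = permInvL τ c
    1≤t = proj₁ (permInvL-inRange τ c∈)
    t+i<i+m : t + i < suc i + suc m
    t+i<i+m = s≤s (subst (t + i ≤_) (+-comm (suc m) i) (+-monoˡ-≤ i (proj₂ (permInvL-inRange τ c∈))))
    unshift : ∀ t → 1 ≤ t → t + i ∸ suc i + 1 ≡ t
    unshift (suc t) _ = trans (cong (_+ 1) (m+n∸n≡m t i)) (+-comm t 1)

  letterwise : ∀ {a} → InRange n a → map B (F (permInvL σ a)) ≡ G a
  letterwise {a} a∈ with <-cmp (permInvL σ a) (suc i)
  ... | tri< b<i b≢i _ = begin
    map B (F (permInvL σ a))                  ≡⟨ cong (map B) (graft-< m _ b<i) ⟩
    [ B (permInvL σ a) ]                      ≡⟨ cong [_] (blockPerm-below (permL σ) (suc m) (permL τ) b<i σb≢s) ⟩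
    [ incLetter m s (permL σ (permInvL σ a)) ] ≡⟨ cong (λ x → [ incLetter m s x ]) (permL-permInvL σ a∈) ⟩
    [ incLetter m s a ]                       ≡⟨ graft-≢ m (inc (s ∸ 1) 0 v) {a} (off-block b≢i) ⟨
    G a                                       ∎
    where
    σb≢s : permL σ (permInvL σ a) ≢ s
    σb≢s = subst (_≢ s) (sym (permL-permInvL σ a∈)) (off-block b≢i)
  ... | tri≈ _ b≡i _ = begin
    map B (F (permInvL σ a))                              ≡⟨ cong (map B ∘′ F) b≡i ⟩
    map B (F (suc i))                                     ≡⟨ cong (map B) (graft-≡ (suc i) m _) ⟩
    map B (map (incLetter i 0) (map (permInvL τ) v))      ≡⟨ cong (map B) (map-∘ v) ⟨
    map B (map (λ c → incLetter i 0 (permInvL τ c)) v)    ≡⟨ map-∘ v ⟨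
    map (λ c → B (incLetter i 0 (permInvL τ c))) v        ≡⟨ map-cong-local (All.map block v∈) ⟩
    inc (s ∸ 1) 0 v                                       ≡⟨ graft-≡ s m _ ⟨
    G s                                                   ≡⟨ cong G a≡s ⟨
    G a                                                   ∎
    where
    a≡s : a ≡ s
    a≡s = trans (sym (permL-permInvL σ a∈)) (cong (permL σ) b≡i)
  ... | tri> _ b≢i i<b = begin
    map B (F (permInvL σ a))                  ≡⟨ cong (map B) (graft-> m _ i<b) ⟩
    [ B (permInvL σ a + m) ]                  ≡⟨ cong [_] (blockPerm-above (permL σ) (suc m) (permL τ) i+m≤b+m σb≢s) ⟩
    [ incLetter m s (permL σ (permInvL σ a + m ∸ m)) ] ≡⟨ cong (λ x → [ incLetter m s x ]) σb≡a ⟩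
    [ incLetter m s a ]                       ≡⟨ graft-≢ m (inc (s ∸ 1) 0 v) {a} (off-block b≢i) ⟨
    G a                                       ∎
    where
    σb≡a : permL σ (permInvL σ a + m ∸ m) ≡ a
    σb≡a = trans (cong (permL σ) (m+n∸n≡m (permInvL σ a) m)) (permL-permInvL σ a∈)
    σb≢s : permL σ (permInvL σ a + m ∸ m) ≢ s
    σb≢s = subst (_≢ s) (sym σb≡a) (off-block b≢i)
    i+m≤b+m : suc i + suc m ≤ permInvL σ a + m
    i+m≤b+m = subst (_≤ permInvL σ a + m) (cong suc (sym (+-suc i m))) (+-monoˡ-≤ m i<b)

comp-equivariant : ∀ {n m u v i} (σ : Permutation′ n) (τ : Permutation′ (suc m)) (ρ : Permutation′ (n + suc m ∸ 1)) →
                   Packed n u → Packed (suc m) v → suc i ≤ n →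
                   (∀ j → suc (toℕ (ρ ⟨$⟩ʳ j)) ≡ blockPerm (permL σ) (suc i) (suc m) (permL τ) (suc (toℕ j))) →
                   comp (suc m) (act u σ) (suc i) (act v τ) ≡ act (comp (suc m) u (permL σ (suc i)) v) ρ
comp-equivariant {n} {m} {u} {v} {i} σ τ ρ u-packed v-packed i<n ρ≗B = begin
  comp (suc m) (act u σ) (suc i) (act v τ)
    ≡⟨ act-map-inverse ρ B ρ≗B (proj₁ (comp-packed (act-packed σ u-packed) (act-packed τ v-packed) i<n)) ⟨
  act (map B (comp (suc m) (act u σ) (suc i) (act v τ))) ρ
    ≡⟨ cong (λ w → act w ρ) (map-blockPerm-comp σ τ (proj₁ u-packed) (proj₁ v-packed) i<n) ⟩
  act (comp (suc m) u (permL σ (suc i)) v) ρ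
    ∎
  where B = blockPerm (permL σ) (suc i) (suc m) (permL τ)

theorem2p3 : IsSymmetricOperadPAs
theorem2p3 = record
  { comp-packed  = λ { n (suc m) u v (suc i) _ _ u-packed v-packed _ i≤n → comp-packed u-packed v-packed i≤n }
  ; act-packed   = λ n u σ _ u-packed → act-packed σ u-packed
  ; unit-packed  = ((s≤s z≤n , s≤s z≤n) ∷ []) , λ { (suc zero) _ _ → here refl ; (suc (suc a)) _ (s≤s ()) }
  ; unit-right   = λ { n u (suc i) _ _ _ _ → comp-unitʳ u i }
  ; unit-left    = λ n u _ _ → comp-unitˡ n u
  ; seq-assoc    = λ { n (suc m) (suc k) x y z (suc i) (suc j) _ _ _ _ (y∈ , _) _ _ _ _ (s≤s j≤m) →
                       comp-seq-assoc x y z i j (All.map proj₁ y∈) j≤m }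
  ; par-assoc    = λ { n (suc m) (suc k) x y z (suc i) (suc j) _ _ _ _ (y∈ , _) (z∈ , _) _ (s≤s i<j) _ →
                       comp-par-assoc x y z i j y∈ (All.map proj₁ z∈) i<j }
  ; act-id       = λ n u _ _ → act-id u
  ; act-comp     = λ n u σ τ _ _ → act-∘ₚ u σ τ
  ; equivariance = λ { n (suc m) u v (suc i) σ τ ρ _ _ u-packed v-packed _ i≤n ρ≗B →
                       comp-equivariant σ τ ρ u-packed v-packed i≤n ρ≗B }
  }
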